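{- Let $\mathcal{M}$ be an $n$-maniplex with a weight function $\omega\colon E(\mathcal{M})\to\mathbb{Z}_k$ and an $\ell$-colouring $\mathcal{C}$ of its facets. If $\mathcal{M}^\omega$ is non-orientable (non-bipartite), then so is $(2^{(\mathcal{M},\mathcal{C})})^{\omega_\mathcal{C}}$.
   Context: An $n$-maniplex is a connected $n$-valent simple graph with a proper edge-colouring by $\{0,\dots,n-1\}$ such that whenever $|i-j|>1$ the edges of colours $i,j$ form a disjoint union of $4$-cycles. Vertices are flags; $u^i$ is the $i$-neighbour of $u$. Facets are the connected components after deleting the edges of colour $n-1$. An $\ell$-colouring is a surjection $\mathcal{C}$ from facets to $\{1,\dots,\ell\}$; a flag's colour is its facet's colour. The colour-coded extension $2^{(\mathcal{M},\mathcal{C})}$ is the $(n+1)$-maniplex with flag set $\mathcal{F}\times\mathbb{Z}_2^\ell$ ($\mathcal{F}$ the flags of $\mathcal{M}$), with $(u,x)^i=(u^i,x)$ for $i<n$ and $(u,x)^n=(u,x^j)$ where $j$ is the colour of $u$ and $x^j$ differs from $x$ only in coordinate $j$. The parity $\sigma(x)$ is $(-1)^b$ with $b$ the number of coordinates of $x$ equal to $1$. The extended weight $\omega_\mathcal{C}$ assigns to the $i$-edge joining $(u,x)$ and $(u^i,x)$ ($i<n$) the value $\sigma(x)\omega(uu^i)$, and $0$ to every $n$-edge. For a graph $\Gamma$ with weight $\omega\colon E(\Gamma)\to\mathbb{Z}_k$, the cross-cover $\Gamma^\omega$ has vertex set $V(\Gamma)\times\mathbb{Z}_k$ with $(u,i)$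 adjacent to $(v,\omega(e)-i)$ for each edge $e=uv$ and $i\in\mathbb{Z}_k$. Non-orientable means non-bipartite. -}

module Defs where

open import Data.Nat using (ℕ; zero; suc; _+_; _∸_; _<_; _%_; _≡ᵇ_; ∣_-_∣; NonZero)
open import Data.Nat.DivMod using (_mod_)
open import Data.Fin using (Fin; zero; suc; toℕ)
open import Data.Bool using (Bool; true; false; not; if_then_else_)
open import Data.Vec using (Vec; countᵇ; _[_]%=_)
open import Data.Maybe using (Maybe; just; nothing)
import Data.Maybe as Maybe
open import Data.Product using (Σ; _×_; _,_; ∃)
open import Data.Unit using (⊤)
open import Relation.Binary.PropositionalEquality using (_≡_; _≢_)
open import Relation.Nullary using (¬_)

module _ {k : ℕ} .{{_ : NonZero k}} where

  0ₖ : Fin k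
  0ₖ = 0 mod k

  -ₖ_ : Fin k → Fin k
  -ₖ a = (k ∸ toℕ a) mod k

  _−ₖ_ : Fin k → Fin k → Fin k
  a −ₖ b = (toℕ a + (k ∸ toℕ b)) mod k

-- Edge-coloured graphs are given by a family of maps  r i : V → V
-- (r i u = u^i, the i-neighbour of u).
-- Reachability along i-edges with colours i satisfying P.

data Reach {V : Set} {n : ℕ} (r : Fin n → V → V) (P : Fin n → Set)
           : V → V → Set where
  here : ∀ {u} → Reach r P u u
  step : ∀ {u v} (i : Fin n) → P i → Reach r P (r i u) v → Reach r P u v

record Maniplex (n : ℕ) : Set₁ where
  field
    Flag      : Set
    r         : Fin n → Flag → Flag
    -- each flag has exactly one i-neighbour, and the relation is symmetric
    r-invol   : ∀ i u → r i (r i u) ≡ u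
    -- simple graph: no loops and no parallel edges
    r-noloop  : ∀ i u → r i u ≢ u
    r-simple  : ∀ i j u → i ≢ j → r i u ≢ r j u
    -- for |i - j| > 1 the i,j-edges form disjoint 4-cycles
    r-comm    : ∀ i j u → 1 < ∣ toℕ i - toℕ j ∣ → r i (r j u) ≡ r j (r i u)
    connected : ∀ u v → Reach r (λ _ → ⊤) u v

open Maniplex public

NotLast : ∀ {n} → Fin n → Set
NotLast {n} i = suc (toℕ i) ≢ n

-- An ℓ-colouring of the facets, given as a colour function on flags
-- that is constant on facets (components after deleting (n-1)-edges)
-- and surjective onto Fin ℓ  (Fin ℓ stands for {1,…,ℓ}).
record Colouring {n : ℕ} (M : Maniplex n) (ℓ : ℕ) : Set where
  field
    col        : Flag M → Fin ℓ
    col-facet  : ∀ i u → NotLast i → col (r M i u) ≡ col u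
    col-surj   : ∀ (c : Fin ℓ) → ∃ λ u → col u ≡ c

open Colouring public

-- A weight ω : E(M) → ℤ_k. An edge of a maniplex is determined by
-- a flag u and colour i, with (u,i) and (u^i,i) the same edge.
record Weight {n : ℕ} (M : Maniplex n) (k : ℕ) : Set where
  field
    w      : Flag M → Fin n → Fin k
    w-edge : ∀ i u → w (r M i u) i ≡ w u i

open Weight public

CrossAdj : ∀ {V : Set} {m k : ℕ} .{{_ : NonZero k}} →
           (Fin m → V → V) → (V → Fin m → Fin k) →
           V × Fin k → V × Fin k → Set
CrossAdj {m = m} r w (u , a) (v , b) =
  Σ (Fin m) λ i → (v ≡ r i u) × (b ≡ w u i −ₖ a)

Bipartite : ∀ {V : Set} → (V → V → Set) → Set
Bipartite {V} Adj = Σ (V → Bool) λ c → ∀ x y → Adj x y → c x ≢ c y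

NonBipartite : ∀ {V : Set} → (V → V → Set) → Set
NonBipartite Adj = ¬ Bipartite Adj

-- colours of 2^(M,C): just j for j < n, nothing for the new colour n
split : ∀ {n} → Fin (suc n) → Maybe (Fin n)
split {zero}  zero    = nothing
split {suc n} zero    = just zero
split {suc n} (suc i) = Maybe.map suc (split i)

-- σ(x) = -1 iff the number of coordinates equal to 1 (true) is odd
oddParity : ∀ {ℓ} → Vec Bool ℓ → Bool
oddParity x = (countᵇ (λ b → b) x % 2) ≡ᵇ 1

module _ {n ℓ : ℕ} (M : Maniplex n) (C : Colouring M ℓ) where

  ExtFlag : Set
  ExtFlag = Flag M × Vec Bool ℓ

  extR : Fin (suc n) → ExtFlag → ExtFlag
  extR i (u , x) with split i
  ... | just j  = (r M j u , x)
  ... | nothing = (u , x [ col C u ]%= not)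

  extW : ∀ {k} .{{_ : NonZero k}} → Weight M k → ExtFlag → Fin (suc n) → Fin k
  extW ω (u , x) i with split i
  ... | just j  = if oddParity x then -ₖ (w ω u j) else w ω u j
  ... | nothing = 0ₖ

{-# OPTIONS --safe #-}
-- M^ω embeds in (2^(M,C))^{ω_C} as the layer x = 0: on flags of even
-- parity the extended weight agrees with ω and the colours i < n act as in
-- M. A proper 2-colouring of the extension's cross-cover therefore
-- restricts to one of M^ω.
module Submission where

open import Defs
open import Data.Nat using (ℕ; NonZero; zero; suc)
open import Data.Fin using (Fin; zero; suc; inject₁)
open import Data.Bool using (false)
open import Data.Vec using (replicate; countᵇ)
open import Data.Maybe using (just)
import Data.Maybe as Maybe
open import Data.Product using (_,_; map₁)
open import Function using (_∘_)
open import Relation.Binary.Core using (Rel)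
open import Relation.Binary.PropositionalEquality using (_≡_; refl; sym; trans; cong)

Homomorphism : ∀ {V W : Set} → Rel V _ → Rel W _ → (V → W) → Set
Homomorphism Adj Adj′ f = ∀ x y → Adj x y → Adj′ (f x) (f y)

Bipartite-reflect : ∀ {V W : Set} {Adj : Rel V _} {Adj′ : Rel W _} (f : V → W) →
                    Homomorphism Adj Adj′ f → Bipartite Adj′ → Bipartite Adj
Bipartite-reflect f hom (c , proper) = c ∘ f , λ x y adj → proper (f x) (f y) (hom x y adj)

NonBipartite-preserve : ∀ {V W : Set} {Adj : Rel V _} {Adj′ : Rel W _} (f : V → W) →
                        Homomorphism Adj Adj′ f → NonBipartite Adj → NonBipartite Adj′
NonBipartite-preserve f hom nb = nb ∘ Bipartite-reflect f hom

module _ {V W : Set} {m m′ k : ℕ} .{{_ : NonZero k}}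
         {r : Fin m → V → V} {w : V → Fin m → Fin k}
         {r′ : Fin m′ → W → W} {w′ : W → Fin m′ → Fin k}
         (f : V → W) (g : Fin m → Fin m′)
         (r-hom : ∀ i u → r′ (g i) (f u) ≡ f (r i u))
         (w-hom : ∀ i u → w′ (f u) (g i) ≡ w u i) where

  CrossAdj-homomorphism : Homomorphism (CrossAdj r w) (CrossAdj r′ w′) (map₁ f)
  CrossAdj-homomorphism (u , a) _ (i , v≡ , b≡) =
    g i , trans (cong f v≡) (sym (r-hom i u)) , trans b≡ (cong (_−ₖ a) (sym (w-hom i u)))

split-inject₁ : ∀ {n} (i : Fin n) → split (inject₁ i) ≡ just i
split-inject₁ {suc n} zero    = refl
split-inject₁ {suc n} (suc i) = cong (Maybe.map suc) (split-inject₁ i)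

countᵇ-replicate-false : ∀ ℓ → countᵇ (λ b → b) (replicate ℓ false) ≡ 0
countᵇ-replicate-false zero    = refl
countᵇ-replicate-false (suc ℓ) = countᵇ-replicate-false ℓ

oddParity-replicate-false : ∀ ℓ → oddParity (replicate ℓ false) ≡ false
oddParity-replicate-false ℓ rewrite countᵇ-replicate-false ℓ = refl

module _ {n ℓ : ℕ} (M : Maniplex n) (C : Colouring M ℓ) where

  extR-inject₁ : ∀ i u x → extR M C (inject₁ i) (u , x) ≡ (r M i u , x)
  extR-inject₁ i u x rewrite split-inject₁ i = refl

  extW-inject₁-even : ∀ {k} .{{_ : NonZero k}} (ω : Weight M k) i u {x} →
                      oddParity x ≡ false → extW M C ω (u , x) (inject₁ i) ≡ w ω u i
  extW-inject₁-even ω i u even rewrite split-inject₁ i | even = refl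

corollary5p3 : ∀ {n ℓ k : ℕ} .{{_ : NonZero k}}
    (M : Maniplex n) (ω : Weight M k) (C : Colouring M ℓ) →
    NonBipartite (CrossAdj (r M) (w ω)) →
    NonBipartite (CrossAdj (extR M C) (extW M C ω))
corollary5p3 {ℓ = ℓ} M ω C =
  NonBipartite-preserve (map₁ zeroLayer)
    (CrossAdj-homomorphism {r′ = extR M C} {w′ = extW M C ω} zeroLayer inject₁ r-hom w-hom)
  where
  zeroLayer : Flag M → ExtFlag M C
  zeroLayer u = u , replicate ℓ false

  r-hom : ∀ i u → extR M C (inject₁ i) (zeroLayer u) ≡ zeroLayer (r M i u)
  r-hom i u = extR-inject₁ M C i u (replicate ℓ false)

  w-hom : ∀ i u → extW M C ω (zeroLayer u) (inject₁ i) ≡ w ω u i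
  w-hom i u = extW-inject₁-even M C ω i u (oddParity-replicate-false ℓ)
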